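{- Let $0<\gamma<1$. For every finite set $V$ and every partition $\Gamma$ of $V$, there exists an edge set $E$ on $V$ such that $\Gamma$ is the unique CPM($\gamma$)-optimal clustering of the network $(V,E)$.
   Context: A network is a finite simple undirected unweighted graph $N=(V,E)$; a clustering is a partition of $V$ into nonempty clusters. For $0<\gamma<1$ the CPM($\gamma$) score of a clustering $\mathcal{C}$ is $\mathcal{H}_\gamma(\mathcal{C})=\sum_{c\in\mathcal{C}}\left(e_c-\gamma\binom{|c|}{2}\right)$, where $e_c$ is the number of edges with both endpoints in $c$; a clustering is CPM($\gamma$)-optimal if it maximizes $\mathcal{H}_\gamma$ over all partitions of $V$.
   Formalization: The parameter γ is taken to be rational, with 0 < γ < 1. -}

module Defs where

open import Data.Nat as ℕ using (ℕ)
open import Data.Nat.Combinatorics using (_C_)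
open import Data.Integer using (+_)
open import Data.Rational using (ℚ; _+_; _-_; _*_; _≤_; _/_; 0ℚ)
open import Data.Fin using (Fin; _<_)
open import Data.Bool using (Bool; true; false; _∧_; if_then_else_)
open import Data.Fin.Properties using (_≟_; _<?_)
open import Relation.Nullary.Decidable using (⌊_⌋)
open import Relation.Binary.PropositionalEquality using (_≡_)
open import Data.Empty using (⊥)
open import Function.Bundles using (_⇔_)
open import Data.Product using (_×_)

Σℕ : (n : ℕ) → (Fin n → ℕ) → ℕ
Σℕ ℕ.zero    f = 0
Σℕ (ℕ.suc n) f = f Data.Fin.zero ℕ.+ Σℕ n (λ i → f (Data.Fin.suc i))

Σℚ : (n : ℕ) → (Fin n → ℚ) → ℚ
Σℚ ℕ.zero    f = 0ℚ
Σℚ (ℕ.suc n) f = f Data.Fin.zero + Σℚ n (λ i → f (Data.Fin.suc i))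

ind : Bool → ℕ
ind true  = 1
ind false = 0

record Network (n : ℕ) : Set where
  field
    adj   : Fin n → Fin n → Bool
    sym   : ∀ i j → adj i j ≡ adj j i
    irref : ∀ i → adj i i ≡ false
open Network public

-- a clustering (partition of Fin n) is given by a cluster label for each
-- vertex; the clusters are the nonempty fibres of the labelling.
-- Labels in Fin n suffice, since a partition of an n-set has ≤ n blocks.
Clustering : ℕ → Set
Clustering n = Fin n → Fin n

SamePartition : ∀ {n} → Clustering n → Clustering n → Set
SamePartition {n} K D = ∀ (x y : Fin n) → (K x ≡ K y) ⇔ (D x ≡ D y)

inCl : ∀ {n} → Clustering n → Fin n → Fin n → Bool
inCl K ℓ x = ⌊ K x ≟ ℓ ⌋

clSize : ∀ {n} → Clustering n → Fin n → ℕ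
clSize {n} K ℓ = Σℕ n (λ x → ind (inCl K ℓ x))

clEdges : ∀ {n} → Network n → Clustering n → Fin n → ℕ
clEdges {n} N K ℓ =
  Σℕ n (λ x → Σℕ n (λ y →
    ind (⌊ x <? y ⌋ ∧ inCl K ℓ x ∧ inCl K ℓ y ∧ adj N x y)))

ℕtoℚ : ℕ → ℚ
ℕtoℚ k = (+ k) / 1

-- CPM(γ) score: Σ_c (e_c − γ·binom(|c|,2)); labels with empty fibre
-- (not actual clusters) contribute 0 − γ·0 = 0.
cpm : ∀ {n} → ℚ → Network n → Clustering n → ℚ
cpm {n} γ N K =
  Σℚ n (λ ℓ → ℕtoℚ (clEdges N K ℓ) - γ * ℕtoℚ (clSize K ℓ C 2))

CPMOptimal : ∀ {n} → ℚ → Network n → Clustering n → Set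
CPMOptimal {n} γ N K = ∀ (D : Clustering n) → cpm γ N D ≤ cpm γ N K

UniqueOptimal : ∀ {n} → ℚ → Network n → Clustering n → Set
UniqueOptimal {n} γ N Γ =
  CPMOptimal γ N Γ × (∀ (D : Clustering n) → CPMOptimal γ N D → SamePartition D Γ)

{-# OPTIONS --safe #-}
module Submission where

-- Realise Γ by the disjoint union of cliques on its clusters.  For a clustering D of this graph
-- let e be the number of edges inside D-clusters and m the number of non-adjacent pairs inside
-- D-clusters; then H(D) = e − γ (e + m), while H(Γ) = (1 − γ) E for the total number E ≥ e of
-- edges.  The difference (1 − γ)(E − e) + γ m is nonnegative, and it vanishes only when every
-- edge lies inside a D-cluster and no D-cluster contains a non-adjacent pair, that is, when D
-- and Γ have the same clusters.

open import Defs hiding (sym)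
open import Data.Nat using (ℕ; zero; suc; _+_; _*_; _≤_; z≤n; s≤s; s<s; s<s⁻¹)
open import Data.Rational using (ℚ; _<_; 0ℚ; 1ℚ)
open import Data.Product using (Σ; _×_; _,_; proj₁; proj₂)

open import Data.Nat.Properties
  using (+-0-commutativeMonoid; ≤-antisym; +-cancelˡ-≡; +-cancelʳ-≤; +-monoʳ-≤; +-mono-≤;
         +-identityʳ; *-identityˡ; m≤n⇒∃[o]m+o≡n)
open import Data.Nat.Combinatorics using (_C_; nCk+nC[k+1]≡[n+1]C[k+1]; nC1≡n)
open import Algebra.Properties.CommutativeMonoid.Sum +-0-commutativeMonoid
  using (sum; ∑-comm; ∑-distrib-+; sum-cong-≗)
import Data.Integer as ℤ
import Data.Integer.Properties as ℤₚ
import Data.Rational as ℚ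
import Data.Rational.Properties as ℚₚ
open import Data.Rational.Solver using (module +-*-Solver)
open import Data.Nat.Coprimality using (1-coprimeTo) renaming (sym to Coprime-sym)
open import Data.Fin as Fin using (Fin; zero; suc)
open import Data.Fin.Properties using (_≟_; _<?_; suc-injective; <⇒≢; <-cmp)
open import Data.Bool using (Bool; true; false; _∧_; not; T)
open import Data.Bool.Properties using (∧-identityʳ; ∧-zeroʳ; ∧-idem; T-≡; T-not-≡)
open import Data.Sum using (_⊎_; inj₁; inj₂)
open import Data.Empty using (⊥-elim)
open import Function.Bundles using (_⇔_; mk⇔; Equivalence)
open import Relation.Nullary using (Dec; yes; no)
open import Relation.Nullary.Decidable using (⌊_⌋; True; fromWitness; fromWitnessFalse; isYes≗does; does-⇔)
open import Relation.Binary.Definitions using (tri<; tri≈; tri>)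
open import Relation.Binary.PropositionalEquality
  using (_≡_; refl; sym; trans; cong; cong₂; subst; subst₂; module ≡-Reasoning)

Σℕ≡sum : ∀ n (f : Fin n → ℕ) → Σℕ n f ≡ sum f
Σℕ≡sum zero    f = refl
Σℕ≡sum (suc n) f = cong (f zero +_) (Σℕ≡sum n (λ i → f (suc i)))

Σℕ-cong : ∀ n {f g : Fin n → ℕ} → (∀ i → f i ≡ g i) → Σℕ n f ≡ Σℕ n g
Σℕ-cong zero    f≗g = refl
Σℕ-cong (suc n) f≗g = cong₂ _+_ (f≗g zero) (Σℕ-cong n (λ i → f≗g (suc i)))

Σℕ-zero : ∀ n → Σℕ n (λ _ → 0) ≡ 0
Σℕ-zero zero    = refl
Σℕ-zero (suc n) = Σℕ-zero n

Σℕ-+ : ∀ n (f g : Fin n → ℕ) → Σℕ n (λ i → f i + g i) ≡ Σℕ n f + Σℕ n g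
Σℕ-+ n f g = begin
  Σℕ n (λ i → f i + g i) ≡⟨ Σℕ≡sum n _ ⟩
  sum (λ i → f i + g i)  ≡⟨ ∑-distrib-+ f g ⟩
  sum f + sum g          ≡⟨ sym (cong₂ _+_ (Σℕ≡sum n f) (Σℕ≡sum n g)) ⟩
  Σℕ n f + Σℕ n g        ∎
  where open ≡-Reasoning

Σℕ-comm : ∀ m n (f : Fin m → Fin n → ℕ) →
  Σℕ m (λ i → Σℕ n (f i)) ≡ Σℕ n (λ j → Σℕ m (λ i → f i j))
Σℕ-comm m n f = begin
  Σℕ m (λ i → Σℕ n (f i))          ≡⟨ double m n f ⟩
  sum (λ i → sum (f i))            ≡⟨ ∑-comm f ⟩
  sum (λ j → sum (λ i → f i j))    ≡⟨ sym (double n m (λ j i → f i j)) ⟩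
  Σℕ n (λ j → Σℕ m (λ i → f i j)) ∎
  where
  open ≡-Reasoning
  double : ∀ m n (f : Fin m → Fin n → ℕ) → Σℕ m (λ i → Σℕ n (f i)) ≡ sum (λ i → sum (f i))
  double m n f = trans (Σℕ≡sum m _) (sum-cong-≗ (λ i → Σℕ≡sum n (f i)))

Σℕ-mono : ∀ n {f g : Fin n → ℕ} → (∀ i → f i ≤ g i) → Σℕ n f ≤ Σℕ n g
Σℕ-mono zero    f≤g = z≤n
Σℕ-mono (suc n) f≤g = +-mono-≤ (f≤g zero) (Σℕ-mono n (λ i → f≤g (suc i)))

+-tight : ∀ {a b c d} → a ≤ c → b ≤ d → a + b ≡ c + d → a ≡ c × b ≡ d
+-tight {a} {b} {c} {d} a≤c b≤d eq = a≡c , +-cancelˡ-≡ a b d (trans eq (cong (_+ d) (sym a≡c)))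
  where
  a≡c : a ≡ c
  a≡c = ≤-antisym a≤c (+-cancelʳ-≤ d c a (subst (_≤ a + d) eq (+-monoʳ-≤ a b≤d)))

Σℕ-tight : ∀ n {f g : Fin n → ℕ} → (∀ i → f i ≤ g i) → Σℕ n f ≡ Σℕ n g → ∀ i → f i ≡ g i
Σℕ-tight (suc n) f≤g eq zero    = proj₁ (+-tight (f≤g zero) (Σℕ-mono n (λ i → f≤g (suc i))) eq)
Σℕ-tight (suc n) f≤g eq (suc i) =
  Σℕ-tight n (λ i → f≤g (suc i)) (proj₂ (+-tight (f≤g zero) (Σℕ-mono n (λ i → f≤g (suc i))) eq)) i

Σℕ≡0⇒≡0 : ∀ n (f : Fin n → ℕ) → Σℕ n f ≡ 0 → ∀ i → f i ≡ 0
Σℕ≡0⇒≡0 n f eq i = sym (Σℕ-tight n (λ _ → z≤n) (trans (Σℕ-zero n) (sym eq)) i)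

ind-injective : ∀ {b c} → ind b ≡ ind c → b ≡ c
ind-injective {false} {false} _ = refl
ind-injective {true}  {true}  _ = refl

ind-∧-true : ∀ {b} c → T b → ind (b ∧ c) ≡ ind c
ind-∧-true {true} c _ = refl

ind-∧-≤ : ∀ a b c → ind (a ∧ b ∧ c) ≤ ind (a ∧ c)
ind-∧-≤ false b     c     = z≤n
ind-∧-≤ true  false c     = z≤n
ind-∧-≤ true  true  false = z≤n
ind-∧-≤ true  true  true  = s≤s z≤n

ind-∧-split : ∀ a b c → ind (a ∧ b) ≡ ind (a ∧ b ∧ c) + ind (a ∧ b ∧ not c)
ind-∧-split false b     c     = refl
ind-∧-split true  false c     = refl
ind-∧-split true  true  false = refl
ind-∧-split true  true  true  = refl

Σℕ-∧ : ∀ n b (c : Fin n → Bool) → Σℕ n (λ i → ind (b ∧ c i)) ≡ ind b * Σℕ n (λ i → ind (c i))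
Σℕ-∧ n false c = Σℕ-zero n
Σℕ-∧ n true  c = sym (+-identityʳ _)

ind-∧ : ∀ a b → ind (a ∧ b) ≡ ind a * ind b
ind-∧ false b = refl
ind-∧ true  b = sym (+-identityʳ _)

⌊⌋-⇔ : ∀ {A B : Set} → A ⇔ B → (a? : Dec A) (b? : Dec B) → ⌊ a? ⌋ ≡ ⌊ b? ⌋
⌊⌋-⇔ A⇔B a? b? = trans (isYes≗does a?) (trans (does-⇔ A⇔B a? b?) (sym (isYes≗does b?)))

⌊⌋-≡⇒⇔ : ∀ {A B : Set} (a? : Dec A) (b? : Dec B) → ⌊ a? ⌋ ≡ ⌊ b? ⌋ → A ⇔ B
⌊⌋-≡⇒⇔ (yes a) (yes b) _ = mk⇔ (λ _ → b) (λ _ → a)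
⌊⌋-≡⇒⇔ (no ¬a) (no ¬b) _ = mk⇔ (λ a → ⊥-elim (¬a a)) (λ b → ⊥-elim (¬b b))

≟-sym : ∀ {n} (a b : Fin n) → ⌊ a ≟ b ⌋ ≡ ⌊ b ≟ a ⌋
≟-sym a b = ⌊⌋-⇔ (mk⇔ sym sym) (a ≟ b) (b ≟ a)

suc-≟ : ∀ {n} (a b : Fin n) → ⌊ suc a ≟ suc b ⌋ ≡ ⌊ a ≟ b ⌋
suc-≟ a b = ⌊⌋-⇔ (mk⇔ suc-injective (cong suc)) (suc a ≟ suc b) (a ≟ b)

suc-<? : ∀ {n} (a b : Fin n) → ⌊ suc a <? suc b ⌋ ≡ ⌊ a <? b ⌋
suc-<? a b = ⌊⌋-⇔ (mk⇔ s<s⁻¹ s<s) (suc a <? suc b) (a <? b)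

Σℕ-δ : ∀ n (c : Fin n) (h : Fin n → Bool) → Σℕ n (λ ℓ → ind (⌊ c ≟ ℓ ⌋ ∧ h ℓ)) ≡ ind (h c)
Σℕ-δ (suc n) zero    h = trans (cong (ind (h zero) +_) (Σℕ-zero n)) (+-identityʳ _)
Σℕ-δ (suc n) (suc c) h =
  trans (Σℕ-cong n (λ ℓ → cong (λ b → ind (b ∧ h (suc ℓ))) (suc-≟ c ℓ))) (Σℕ-δ n c (λ ℓ → h (suc ℓ)))

pairs : ∀ {n} → (Fin n → Fin n → Bool) → ℕ
pairs {n} P = Σℕ n (λ x → Σℕ n (λ y → ind (⌊ x <? y ⌋ ∧ P x y)))

pairs-cong : ∀ {n} {P Q : Fin n → Fin n → Bool} →
  (∀ {x y} → x Fin.< y → P x y ≡ Q x y) → pairs P ≡ pairs Q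
pairs-cong {n} {P} {Q} P≡Q = Σℕ-cong n (λ x → Σℕ-cong n (λ y → on x y))
  where
  on : ∀ x y → ind (⌊ x <? y ⌋ ∧ P x y) ≡ ind (⌊ x <? y ⌋ ∧ Q x y)
  on x y with x <? y
  ... | yes x<y = cong ind (P≡Q x<y)
  ... | no  _   = refl

pairs-split : ∀ {n} (P Q : Fin n → Fin n → Bool) →
  pairs P ≡ pairs (λ x y → P x y ∧ Q x y) + pairs (λ x y → P x y ∧ not (Q x y))
pairs-split {n} P Q = trans (Σℕ-cong n row) (Σℕ-+ n _ _)
  where
  row : ∀ x → Σℕ n (λ y → ind (⌊ x <? y ⌋ ∧ P x y))
            ≡ Σℕ n (λ y → ind (⌊ x <? y ⌋ ∧ P x y ∧ Q x y))
              + Σℕ n (λ y → ind (⌊ x <? y ⌋ ∧ P x y ∧ not (Q x y)))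
  row x = trans (Σℕ-cong n (λ y → ind-∧-split ⌊ x <? y ⌋ (P x y) (Q x y))) (Σℕ-+ n _ _)

pairs-∧-≤ : ∀ {n} (P Q : Fin n → Fin n → Bool) → pairs (λ x y → P x y ∧ Q x y) ≤ pairs Q
pairs-∧-≤ {n} P Q = Σℕ-mono n (λ x → Σℕ-mono n (λ y → ind-∧-≤ ⌊ x <? y ⌋ (P x y) (Q x y)))

pairs-∧-≡⇒ : ∀ {n} (P Q : Fin n → Fin n → Bool) → pairs (λ x y → P x y ∧ Q x y) ≡ pairs Q →
  ∀ {x y} → x Fin.< y → P x y ∧ Q x y ≡ Q x y
pairs-∧-≡⇒ {n} P Q eq {x} {y} x<y = ind-injective (begin
  ind (P x y ∧ Q x y)             ≡⟨ ind-∧-true _ x<?y ⟨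
  ind (⌊ x <? y ⌋ ∧ P x y ∧ Q x y) ≡⟨ Σℕ-tight n (≤-at x) (Σℕ-tight n (λ x → Σℕ-mono n (≤-at x)) eq x) y ⟩
  ind (⌊ x <? y ⌋ ∧ Q x y)         ≡⟨ ind-∧-true _ x<?y ⟩
  ind (Q x y)                     ∎)
  where
  open ≡-Reasoning
  x<?y : True (x <? y)
  x<?y = fromWitness x<y
  ≤-at : ∀ x y → ind (⌊ x <? y ⌋ ∧ P x y ∧ Q x y) ≤ ind (⌊ x <? y ⌋ ∧ Q x y)
  ≤-at x y = ind-∧-≤ ⌊ x <? y ⌋ (P x y) (Q x y)

pairs≡0⇒ : ∀ {n} (P : Fin n → Fin n → Bool) → pairs P ≡ 0 → ∀ {x y} → x Fin.< y → P x y ≡ false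
pairs≡0⇒ {n} P eq {x} {y} x<y = ind-injective (begin
  ind (P x y)              ≡⟨ ind-∧-true _ (fromWitness x<y) ⟨
  ind (⌊ x <? y ⌋ ∧ P x y) ≡⟨ Σℕ≡0⇒≡0 n _ (Σℕ≡0⇒≡0 n _ eq x) y ⟩
  0                        ∎)
  where open ≡-Reasoning

pairs-suc : ∀ {n} (P : Fin (suc n) → Fin (suc n) → Bool) →
  pairs P ≡ Σℕ n (λ y → ind (P zero (suc y))) + pairs (λ x y → P (suc x) (suc y))
pairs-suc {n} P = cong (Σℕ n (λ y → ind (P zero (suc y))) +_)
  (Σℕ-cong n (λ x → Σℕ-cong n (λ y → cong (λ b → ind (b ∧ P (suc x) (suc y))) (suc-<? x y))))

[ind+n]C2≡ind*n+nC2 : ∀ b n → (ind b + n) C 2 ≡ ind b * n + n C 2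
[ind+n]C2≡ind*n+nC2 false n = refl
[ind+n]C2≡ind*n+nC2 true  n = begin
  suc n C 2      ≡⟨ nCk+nC[k+1]≡[n+1]C[k+1] n 1 ⟨
  n C 1 + n C 2  ≡⟨ cong (_+ n C 2) (trans (nC1≡n n) (sym (*-identityˡ n))) ⟩
  1 * n + n C 2  ∎
  where open ≡-Reasoning

pairs-C₂ : ∀ n (b : Fin n → Bool) → Σℕ n (λ x → ind (b x)) C 2 ≡ pairs (λ x y → b x ∧ b y)
pairs-C₂ zero    b = refl
pairs-C₂ (suc n) b = begin
  (ind (b zero) + s) C 2
    ≡⟨ [ind+n]C2≡ind*n+nC2 (b zero) s ⟩
  ind (b zero) * s + s C 2
    ≡⟨ cong₂ _+_ (sym (Σℕ-∧ n (b zero) (λ y → b (suc y)))) (pairs-C₂ n (λ x → b (suc x))) ⟩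
  Σℕ n (λ y → ind (b zero ∧ b (suc y))) + pairs (λ x y → b (suc x) ∧ b (suc y))
    ≡⟨ pairs-suc (λ x y → b x ∧ b y) ⟨
  pairs (λ x y → b x ∧ b y)
    ∎
  where
  open ≡-Reasoning
  s : ℕ
  s = Σℕ n (λ x → ind (b (suc x)))

sameCluster : ∀ {n} → Clustering n → Fin n → Fin n → Bool
sameCluster K x y = inCl K (K x) y

Σ-pairs-clusters : ∀ {n} (K : Clustering n) (h : Fin n → Fin n → Fin n → Bool) →
  Σℕ n (λ ℓ → pairs (λ x y → inCl K ℓ x ∧ h ℓ x y)) ≡ pairs (λ x y → h (K x) x y)
Σ-pairs-clusters {n} K h = begin
  Σℕ n (λ ℓ → Σℕ n (λ x → Σℕ n (λ y → term ℓ x y)))  ≡⟨ Σℕ-comm n n _ ⟩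
  Σℕ n (λ x → Σℕ n (λ ℓ → Σℕ n (λ y → term ℓ x y)))  ≡⟨ Σℕ-cong n (λ x → Σℕ-comm n n _) ⟩
  Σℕ n (λ x → Σℕ n (λ y → Σℕ n (λ ℓ → term ℓ x y)))  ≡⟨ Σℕ-cong n (λ x → Σℕ-cong n (λ y → at x y)) ⟩
  pairs (λ x y → h (K x) x y)                         ∎
  where
  open ≡-Reasoning
  term : Fin n → Fin n → Fin n → ℕ
  term ℓ x y = ind (⌊ x <? y ⌋ ∧ inCl K ℓ x ∧ h ℓ x y)
  at : ∀ x y → Σℕ n (λ ℓ → term ℓ x y) ≡ ind (⌊ x <? y ⌋ ∧ h (K x) x y)
  at x y = begin
    Σℕ n (λ ℓ → term ℓ x y)
      ≡⟨ Σℕ-∧ n ⌊ x <? y ⌋ _ ⟩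
    ind ⌊ x <? y ⌋ * Σℕ n (λ ℓ → ind (inCl K ℓ x ∧ h ℓ x y))
      ≡⟨ cong (ind ⌊ x <? y ⌋ *_) (Σℕ-δ n (K x) (λ ℓ → h ℓ x y)) ⟩
    ind ⌊ x <? y ⌋ * ind (h (K x) x y)
      ≡⟨ ind-∧ ⌊ x <? y ⌋ (h (K x) x y) ⟨
    ind (⌊ x <? y ⌋ ∧ h (K x) x y)
      ∎

ℕtoℚ≡mkℚ : ∀ a → ℕtoℚ a ≡ ℚ.mkℚ (ℤ.+ a) 0 (Coprime-sym (1-coprimeTo a))
ℕtoℚ≡mkℚ a = ℚₚ.normalize-coprime (Coprime-sym (1-coprimeTo a))

ℕtoℚ-+ : ∀ a b → ℕtoℚ (a + b) ≡ ℕtoℚ a ℚ.+ ℕtoℚ b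
ℕtoℚ-+ a b = begin
  ℕtoℚ (a + b)                                       ≡⟨ ℚₚ./-cong numerators refl ⟩
  -- the sum of two fractions with denominator 1 unfolds to this normalisation
  (ℤ.+ a ℤ.* ℤ.+ 1 ℤ.+ ℤ.+ b ℤ.* ℤ.+ 1) ℚ./ (1 * 1)   ≡⟨ cong₂ ℚ._+_ (ℕtoℚ≡mkℚ a) (ℕtoℚ≡mkℚ b) ⟨
  ℕtoℚ a ℚ.+ ℕtoℚ b                                  ∎
  where
  open ≡-Reasoning
  numerators : ℤ.+ (a + b) ≡ ℤ.+ a ℤ.* ℤ.+ 1 ℤ.+ ℤ.+ b ℤ.* ℤ.+ 1
  numerators = trans (ℤₚ.pos-+ a b) (sym (cong₂ ℤ._+_ (ℤₚ.*-identityʳ (ℤ.+ a)) (ℤₚ.*-identityʳ (ℤ.+ b))))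

cpmValue : ℚ → ℕ → ℕ → ℚ
cpmValue γ e p = ℕtoℚ e ℚ.- γ ℚ.* ℕtoℚ p

cpmValue-+ : ∀ γ a b c d → cpmValue γ a b ℚ.+ cpmValue γ c d ≡ cpmValue γ (a + c) (b + d)
cpmValue-+ γ a b c d = begin
  cpmValue γ a b ℚ.+ cpmValue γ c d
    ≡⟨ solve 5 (λ γ a b c d → (a :- γ :* b) :+ (c :- γ :* d) := (a :+ c) :- γ :* (b :+ d))
               refl γ (ℕtoℚ a) (ℕtoℚ b) (ℕtoℚ c) (ℕtoℚ d) ⟩
  (ℕtoℚ a ℚ.+ ℕtoℚ c) ℚ.- γ ℚ.* (ℕtoℚ b ℚ.+ ℕtoℚ d)
    ≡⟨ cong₂ (λ e p → e ℚ.- γ ℚ.* p) (ℕtoℚ-+ a c) (ℕtoℚ-+ b d) ⟨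
  cpmValue γ (a + c) (b + d)
    ∎
  where
  open ≡-Reasoning
  open +-*-Solver

Σℚ-cpmValue : ∀ γ n (e p : Fin n → ℕ) →
  Σℚ n (λ ℓ → cpmValue γ (e ℓ) (p ℓ)) ≡ cpmValue γ (Σℕ n e) (Σℕ n p)
Σℚ-cpmValue γ zero    e p = solve 1 (λ γ → con 0ℚ := con 0ℚ :- γ :* con 0ℚ) refl γ
  where open +-*-Solver
Σℚ-cpmValue γ (suc n) e p =
  trans (cong (cpmValue γ (e zero) (p zero) ℚ.+_) (Σℚ-cpmValue γ n (λ ℓ → e (suc ℓ)) (λ ℓ → p (suc ℓ))))
        (cpmValue-+ γ (e zero) (p zero) _ _)

intraEdges : ∀ {n} → Network n → Clustering n → ℕ
intraEdges N K = pairs (λ x y → sameCluster K x y ∧ adj N x y)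

intraNonEdges : ∀ {n} → Network n → Clustering n → ℕ
intraNonEdges N K = pairs (λ x y → sameCluster K x y ∧ not (adj N x y))

edgeCount : ∀ {n} → Network n → ℕ
edgeCount N = pairs (adj N)

cpm-pairs : ∀ {n} γ (N : Network n) (K : Clustering n) →
  cpm γ N K ≡ cpmValue γ (intraEdges N K) (pairs (sameCluster K))
cpm-pairs {n} γ N K = trans (Σℚ-cpmValue γ n _ _) (cong₂ (cpmValue γ) edges intraPairs)
  where
  edges : Σℕ n (clEdges N K) ≡ intraEdges N K
  edges = Σ-pairs-clusters K (λ ℓ x y → inCl K ℓ y ∧ adj N x y)
  intraPairs : Σℕ n (λ ℓ → clSize K ℓ C 2) ≡ pairs (sameCluster K)
  intraPairs = trans (Σℕ-cong n (λ ℓ → pairs-C₂ n (inCl K ℓ))) (Σ-pairs-clusters K (λ ℓ x y → inCl K ℓ y))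

cpmGap : ℚ → ℕ → ℕ → ℚ
cpmGap γ k m = (1ℚ ℚ.- γ) ℚ.* ℕtoℚ k ℚ.+ γ ℚ.* ℕtoℚ m

cpmValue-gap : ∀ γ e k m → cpmValue γ (e + k) (e + k) ≡ cpmValue γ e (e + m) ℚ.+ cpmGap γ k m
cpmValue-gap γ e k m = begin
  cpmValue γ (e + k) (e + k)
    ≡⟨ cong (λ x → x ℚ.- γ ℚ.* x) (ℕtoℚ-+ e k) ⟩
  (ℕtoℚ e ℚ.+ ℕtoℚ k) ℚ.- γ ℚ.* (ℕtoℚ e ℚ.+ ℕtoℚ k)
    ≡⟨ solve 4 (λ γ e k m → (e :+ k) :- γ :* (e :+ k)
                         := (e :- γ :* (e :+ m)) :+ ((con 1ℚ :- γ) :* k :+ γ :* m))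
               refl γ (ℕtoℚ e) (ℕtoℚ k) (ℕtoℚ m) ⟩
  (ℕtoℚ e ℚ.- γ ℚ.* (ℕtoℚ e ℚ.+ ℕtoℚ m)) ℚ.+ cpmGap γ k m
    ≡⟨ cong (λ p → (ℕtoℚ e ℚ.- γ ℚ.* p) ℚ.+ cpmGap γ k m) (ℕtoℚ-+ e m) ⟨
  cpmValue γ e (e + m) ℚ.+ cpmGap γ k m
    ∎
  where
  open ≡-Reasoning
  open +-*-Solver

p≤p+q : ∀ p q → .{{ℚ.NonNegative q}} → p ℚ.≤ p ℚ.+ q
p≤p+q p q = subst (ℚ._≤ p ℚ.+ q) (ℚₚ.+-identityʳ p) (ℚₚ.+-monoʳ-≤ p (ℚₚ.nonNegative⁻¹ q))

p<p+q : ∀ p q → .{{ℚ.Positive q}} → p < p ℚ.+ q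
p<p+q p q = subst (_< p ℚ.+ q) (ℚₚ.+-identityʳ p) (ℚₚ.+-monoʳ-< p (ℚₚ.positive⁻¹ q))

nonNeg-scaled : ∀ c .{{_ : ℚ.NonNegative c}} k → ℚ.NonNegative (c ℚ.* ℕtoℚ k)
nonNeg-scaled c k = ℚₚ.nonNeg*nonNeg⇒nonNeg c (ℕtoℚ k) {{ℚₚ.normalize-nonNeg k 1}}

pos-scaled : ∀ c .{{_ : ℚ.Positive c}} k → ℚ.Positive (c ℚ.* ℕtoℚ (suc k))
pos-scaled c k = ℚₚ.pos*pos⇒pos c (ℕtoℚ (suc k)) {{ℚₚ.normalize-pos (suc k) 1}}

module _ {γ : ℚ} (0<γ : 0ℚ < γ) (γ<1 : γ < 1ℚ) where

  private instance
    γ-pos : ℚ.Positive γ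
    γ-pos = ℚ.positive 0<γ
    γ-nonNeg : ℚ.NonNegative γ
    γ-nonNeg = ℚₚ.pos⇒nonNeg γ
    1-γ-pos : ℚ.Positive (1ℚ ℚ.- γ)
    1-γ-pos = ℚ.positive (subst (_< 1ℚ ℚ.- γ) (ℚₚ.+-inverseʳ γ) (ℚₚ.+-monoˡ-< (ℚ.- γ) γ<1))
    1-γ-nonNeg : ℚ.NonNegative (1ℚ ℚ.- γ)
    1-γ-nonNeg = ℚₚ.pos⇒nonNeg (1ℚ ℚ.- γ)

  cpmGap-nonNeg : ∀ k m → ℚ.NonNegative (cpmGap γ k m)
  cpmGap-nonNeg k m = ℚₚ.nonNeg+nonNeg⇒nonNeg
    ((1ℚ ℚ.- γ) ℚ.* ℕtoℚ k) {{nonNeg-scaled (1ℚ ℚ.- γ) k}} (γ ℚ.* ℕtoℚ m) {{nonNeg-scaled γ m}}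

  cpmGap≡0⊎pos : ∀ k m → (k ≡ 0 × m ≡ 0) ⊎ ℚ.Positive (cpmGap γ k m)
  cpmGap≡0⊎pos zero    zero    = inj₁ (refl , refl)
  cpmGap≡0⊎pos (suc k) m       = inj₂ (ℚₚ.pos+nonNeg⇒pos
    ((1ℚ ℚ.- γ) ℚ.* ℕtoℚ (suc k)) {{pos-scaled (1ℚ ℚ.- γ) k}} (γ ℚ.* ℕtoℚ m) {{nonNeg-scaled γ m}})
  cpmGap≡0⊎pos zero    (suc m) = inj₂ (ℚₚ.nonNeg+pos⇒pos
    ((1ℚ ℚ.- γ) ℚ.* 0ℚ) {{nonNeg-scaled (1ℚ ℚ.- γ) 0}} (γ ℚ.* ℕtoℚ (suc m)) {{pos-scaled γ m}})

  cpmValue-≤ : ∀ {e t} m → e ≤ t → cpmValue γ e (e + m) ℚ.≤ cpmValue γ t t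
  cpmValue-≤ {e} m e≤t with k , refl ← m≤n⇒∃[o]m+o≡n e≤t =
    subst (cpmValue γ e (e + m) ℚ.≤_) (sym (cpmValue-gap γ e k m)) (p≤p+q _ _ {{cpmGap-nonNeg k m}})

  cpmValue-≥⇒ : ∀ {e t} m → e ≤ t → cpmValue γ t t ℚ.≤ cpmValue γ e (e + m) → e ≡ t × m ≡ 0
  cpmValue-≥⇒ {e} m e≤t t≤e with k , refl ← m≤n⇒∃[o]m+o≡n e≤t | cpmGap≡0⊎pos k m
  ... | inj₁ (refl , refl) = sym (+-identityʳ e) , refl
  ... | inj₂ gap-pos        = ⊥-elim (ℚₚ.<-irrefl refl (ℚₚ.<-≤-trans
          (p<p+q _ _ {{gap-pos}}) (subst (ℚ._≤ _) (cpmValue-gap γ e k m) t≤e)))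

x∧y≡y⇒x∧noty≡false⇒x≡y : ∀ x y → x ∧ y ≡ y → x ∧ not y ≡ false → x ≡ y
x∧y≡y⇒x∧noty≡false⇒x≡y false false _ _ = refl
x∧y≡y⇒x∧noty≡false⇒x≡y true  true  _ _ = refl

samePartition-on-< : ∀ {n} {K D : Clustering n} →
  (∀ {x y} → x Fin.< y → sameCluster K x y ≡ sameCluster D x y) → SamePartition K D
samePartition-on-< {K = K} {D} agree x y with <-cmp x y
... | tri< x<y _ _ = ⌊⌋-≡⇒⇔ (K x ≟ K y) (D x ≟ D y)
                       (trans (≟-sym (K x) (K y)) (trans (agree x<y) (≟-sym (D y) (D x))))
... | tri≈ _ refl _ = mk⇔ (λ _ → refl) (λ _ → refl)
... | tri> _ _ y<x = ⌊⌋-≡⇒⇔ (K x ≟ K y) (D x ≟ D y) (agree y<x)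

cpm-split : ∀ {n} γ (N : Network n) (K : Clustering n) →
  cpm γ N K ≡ cpmValue γ (intraEdges N K) (intraEdges N K + intraNonEdges N K)
cpm-split γ N K =
  trans (cpm-pairs γ N K) (cong (cpmValue γ (intraEdges N K)) (pairs-split (sameCluster K) (adj N)))

clusterGraph : ∀ {n} → Clustering n → Network n
clusterGraph Γ = record
  { adj   = λ x y → sameCluster Γ x y ∧ not ⌊ x ≟ y ⌋
  ; sym   = λ x y → cong₂ (λ s d → s ∧ not d) (≟-sym (Γ y) (Γ x)) (≟-sym x y)
  ; irref = λ x → trans (cong (λ d → sameCluster Γ x x ∧ not d) (Equivalence.to T-≡ (fromWitness refl)))
                        (∧-zeroʳ _)
  }

clusterGraph-adj : ∀ {n} (Γ : Clustering n) {x y} → x Fin.< y → adj (clusterGraph Γ) x y ≡ sameCluster Γ x y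
clusterGraph-adj Γ {x} {y} x<y =
  trans (cong (λ d → sameCluster Γ x y ∧ not d) (Equivalence.to T-not-≡ (fromWitnessFalse (<⇒≢ x<y))))
        (∧-identityʳ _)

cpm-clusterGraph : ∀ {n} γ (Γ : Clustering n) →
  cpm γ (clusterGraph Γ) Γ ≡ cpmValue γ (edgeCount (clusterGraph Γ)) (edgeCount (clusterGraph Γ))
cpm-clusterGraph γ Γ = trans (cpm-pairs γ N Γ) (cong₂ (cpmValue γ) edges intraPairs)
  where
  N : Network _
  N = clusterGraph Γ
  edges : intraEdges N Γ ≡ edgeCount N
  edges = pairs-cong (λ {x} {y} x<y → trans (cong (sameCluster Γ x y ∧_) (clusterGraph-adj Γ x<y))
                                             (trans (∧-idem _) (sym (clusterGraph-adj Γ x<y))))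
  intraPairs : pairs (sameCluster Γ) ≡ edgeCount N
  intraPairs = pairs-cong (λ x<y → sym (clusterGraph-adj Γ x<y))

module _ {γ : ℚ} (0<γ : 0ℚ < γ) (γ<1 : γ < 1ℚ) {n} (Γ : Clustering n) where

  clusterGraph-optimal : CPMOptimal γ (clusterGraph Γ) Γ
  clusterGraph-optimal D = subst₂ ℚ._≤_ (sym (cpm-split γ (clusterGraph Γ) D)) (sym (cpm-clusterGraph γ Γ))
    (cpmValue-≤ 0<γ γ<1 _ (pairs-∧-≤ (sameCluster D) (adj (clusterGraph Γ))))

  clusterGraph-unique : ∀ D → CPMOptimal γ (clusterGraph Γ) D → SamePartition D Γ
  clusterGraph-unique D D-optimal = samePartition-on-< agree
    where
    N : Network n
    N = clusterGraph Γ
    tight : intraEdges N D ≡ edgeCount N × intraNonEdges N D ≡ 0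
    tight = cpmValue-≥⇒ 0<γ γ<1 _ (pairs-∧-≤ (sameCluster D) (adj N))
              (subst₂ ℚ._≤_ (cpm-clusterGraph γ Γ) (cpm-split γ N D) (D-optimal Γ))
    agree : ∀ {x y} → x Fin.< y → sameCluster D x y ≡ sameCluster Γ x y
    agree x<y = trans (x∧y≡y⇒x∧noty≡false⇒x≡y _ _
                        (pairs-∧-≡⇒ (sameCluster D) (adj N) (proj₁ tight) x<y)
                        (pairs≡0⇒ (λ x y → sameCluster D x y ∧ not (adj N x y)) (proj₂ tight) x<y))
                      (clusterGraph-adj Γ x<y)

lemma2 : (γ : ℚ) → 0ℚ < γ → γ < 1ℚ →
    (n : ℕ) (Γ : Clustering n) → Σ (Network n) (λ N → UniqueOptimal γ N Γ)
lemma2 γ 0<γ γ<1 n Γ =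
  clusterGraph Γ , clusterGraph-optimal 0<γ γ<1 Γ , clusterGraph-unique 0<γ γ<1 Γ
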